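{- Let $X$ be a topological space satisfying ${\sf S}_1(\Omega_X,\Omega_X)$ and let $A\in\Omega_X$ be countable with a fixed bijective enumeration. If $R$ and $S$ are completely Ramsey subsets of $[A]^{\aleph_0}\cap\Omega_X$, then $R\cup S$ is completely Ramsey.
   Context: An $\omega$-cover of $X$ is an open cover $\mathcal{U}$ with $X\notin\mathcal{U}$ such that each finite subset of $X$ lies in some member of $\mathcal{U}$; $\Omega_X$ is the set of $\omega$-covers. ${\sf S}_1(\Omega_X,\Omega_X)$: for every sequence of $\omega$-covers $(\mathcal{U}_n)$ there are $U_n\in\mathcal{U}_n$ with $\{U_n:n\in\mathbb{N}\}$ an $\omega$-cover. $[S]^{\aleph_0}$ denotes the countably infinite subsets of $S$. With the enumeration $A=\{a_n:n\in\mathbb{N}\}$: for $s,T\subseteq A$, $s<T$ means $a_n\in s$, $a_m\in T$ imply $n<m$; $B|s=\{a_n\in B:s<\{a_n\}\}$; for finite $s$ and infinite $C$ with $s<C$, $[s,C]=\{s\cup D: D\in[A]^{\aleph_0},D\subseteq C\}$. A set $R\subseteq[A]^{\aleph_0}\cap\Omega_X$ is completely Ramsey if for every finite $s\subseteq A$ and every $B\in[A|s]^{\aleph_0}\cap\Omega_X$ there is $C\in[B]^{\aleph_0}\cap\Omega_X$ with either $[s,C]\cap\Omega_X\subseteq R$ or $[s,C]\cap\Omega_X\cap R=\emptyset$. -}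

module Defs where

open import Level using (Level; 0ℓ) renaming (suc to lsuc)
open import Data.Nat using (ℕ; _<_)
open import Data.Product using (Σ; ∃; _×_; _,_)
open import Data.Sum using (_⊎_)
open import Data.Unit using (⊤)
open import Data.Empty using (⊥)
open import Data.List using (List)
open import Data.List.Relation.Unary.All using (All)
open import Data.List.Membership.Propositional using (_∈_)
open import Relation.Nullary using (¬_)
open import Relation.Binary.PropositionalEquality using (_≡_)

record Topology : Set₁ where
  field
    Carrier : Set
    Open    : (Carrier → Set) → Set
    open-whole : Open (λ _ → ⊤)
    open-empty : Open (λ _ → ⊥)
    open-union : (I : Set) (U : I → Carrier → Set) →
                 (∀ i → Open (U i)) → Open (λ x → Σ I (λ i → U i x))
    open-inter : (U V : Carrier → Set) → Open U → Open V →
                 Open (λ x → U x × V x)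

SameSet : {X : Set} → (X → Set) → (X → Set) → Set
SameSet {X} V W = ∀ (x : X) → (V x → W x) × (W x → V x)

module _ (T : Topology) where
  open Topology T

  Family : Set₂
  Family = (Carrier → Set) → Set₁

  -- ω-cover: open cover, X not a member, every finite subset of X
  -- (given as a list) lies in some member.
  OmegaCover : Family → Set₁
  OmegaCover 𝒰 =
      (∀ V → 𝒰 V → Open V)
    × (∀ V → 𝒰 V → ¬ (∀ x → V x))
    × (∀ (F : List Carrier) → Σ (Carrier → Set) (λ V → 𝒰 V × All V F))

  RangeFam : (ℕ → Carrier → Set) → Family
  RangeFam U V = ∃ λ n → V ≡ U n

  S1-Omega-Omega : Set₂
  S1-Omega-Omega =
    (𝒰 : ℕ → Family) → (∀ n → OmegaCover (𝒰 n)) →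
    Σ (ℕ → Carrier → Set) λ U → (∀ n → 𝒰 n (U n)) × OmegaCover (RangeFam U)

  -- A = {a n : n ∈ ℕ} with a fixed bijective enumeration a.
  -- Subsets of A are represented by their index sets (predicates on ℕ).
  module _ (a : ℕ → Carrier → Set) where

    FamOf : (ℕ → Set) → Family
    FamOf B V = ∃ λ n → B n × V ≡ a n

    InOmega : (ℕ → Set) → Set₁
    InOmega B = OmegaCover (FamOf B)

Infinite : (ℕ → Set) → Set
Infinite B = ∀ n → ∃ λ m → n < m × B m

_⊆ˢ_ : (ℕ → Set) → (ℕ → Set) → Set
B ⊆ˢ C = ∀ m → B m → C m

Above : List ℕ → ℕ → Set
Above s m = ∀ n → n ∈ s → n < m

InSeg : List ℕ → (ℕ → Set) → (ℕ → Set) → Set₁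
InSeg s C T = Σ (ℕ → Set) λ D →
  Infinite D × D ⊆ˢ C × (∀ m → (T m → (m ∈ s ⊎ D m)) × ((m ∈ s ⊎ D m) → T m))

module _ (T : Topology) (a : ℕ → Topology.Carrier T → Set) where

  SubsetOfInfOmega : ((ℕ → Set) → Set) → Set₁
  SubsetOfInfOmega R = ∀ B → R B → Infinite B × InOmega T a B

  CompletelyRamsey : ((ℕ → Set) → Set) → Set₁
  CompletelyRamsey R =
    (s : List ℕ) (B : ℕ → Set) →
    B ⊆ˢ Above s → Infinite B → InOmega T a B →
    Σ (ℕ → Set) λ C → C ⊆ˢ B × Infinite C × InOmega T a C ×
      ( (∀ U → InSeg s C U → InOmega T a U → R U)
      ⊎ (∀ U → InSeg s C U → InOmega T a U → ¬ R U))

-- Refine B first to a C homogeneous for R and then to a D ⊆ C homogeneous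
-- for S. If either refinement lands inside its set, [s, D] lies inside
-- R ∪ S; otherwise [s, D] ⊆ [s, C] misses both R and S.
module Submission where

open import Defs
open import Data.Nat using (ℕ)
open import Data.Unit using (⊤)
open import Data.Sum using (_⊎_; inj₁; inj₂)
open import Data.Product using (_,_)
open import Relation.Binary.PropositionalEquality using (_≡_)
open import Relation.Nullary using (¬_)

⊆ˢ-trans : ∀ {B C D} → D ⊆ˢ C → C ⊆ˢ B → D ⊆ˢ B
⊆ˢ-trans D⊆C C⊆B m d = C⊆B m (D⊆C m d)

InSeg-mono : ∀ s {C D} U → D ⊆ˢ C → InSeg s D U → InSeg s C U
InSeg-mono s U D⊆C (E , infE , E⊆D , U≡s∪E) = E , infE , ⊆ˢ-trans E⊆D D⊆C , U≡s∪E

module _ (T : Topology) (a : ℕ → Topology.Carrier T → Set) where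

  CompletelyRamsey-∪ : ∀ {R S} → CompletelyRamsey T a R → CompletelyRamsey T a S →
                       CompletelyRamsey T a (λ U → R U ⊎ S U)
  CompletelyRamsey-∪ {R} {S} ramseyR ramseyS s B B⊆A|s infB omB
    with ramseyR s B B⊆A|s infB omB
  ... | C , C⊆B , infC , omC , inj₁ inR =
    C , C⊆B , infC , omC , inj₁ (λ U seg om → inj₁ (inR U seg om))
  ... | C , C⊆B , infC , omC , inj₂ outR
    with ramseyS s C (⊆ˢ-trans C⊆B B⊆A|s) infC omC
  ... | D , D⊆C , infD , omD , inj₁ inS =
    D , ⊆ˢ-trans D⊆C C⊆B , infD , omD , inj₁ (λ U seg om → inj₂ (inS U seg om))
  ... | D , D⊆C , infD , omD , inj₂ outS =
    D , ⊆ˢ-trans D⊆C C⊆B , infD , omD , inj₂ outR∪S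
    where
    outR∪S : ∀ U → InSeg s D U → InOmega T a U → ¬ (R U ⊎ S U)
    outR∪S U seg om (inj₁ r) = outR U (InSeg-mono s U D⊆C seg) om r
    outR∪S U seg om (inj₂ x) = outS U seg om x

lemma4 : (T : Topology) → S1-Omega-Omega T →
         (a : ℕ → Topology.Carrier T → Set) →
         (∀ n m → SameSet (a n) (a m) → n ≡ m) →
         InOmega T a (λ _ → ⊤) →
         (R S : (ℕ → Set) → Set) →
         SubsetOfInfOmega T a R → SubsetOfInfOmega T a S →
         CompletelyRamsey T a R → CompletelyRamsey T a S →
         CompletelyRamsey T a (λ U → R U ⊎ S U)
lemma4 T _ a _ _ R S _ _ = CompletelyRamsey-∪ T a
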